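{- Let $b\ge 2$ be even. Then the multiplicity of $b$-ARH numbers is unbounded: for every positive integer $m$ there is a $b$-ARH number having at least $m$ distinct additive multipliers.
   Context: For a positive integer $N$, $s_b(N)$ is the sum of the base-$b$ digits of $N$, and the reversal $N^R$ is the integer obtained by writing the base-$b$ digits of $N$ in reverse order. A positive integer $N$ is a $b$-ARH number if there exists a positive integer $M$ (called an additive multiplier of $N$) such that $N=Ms_b(N)+(Ms_b(N))^R$. The multiplicity of a $b$-ARH number is the cardinality of its set of additive multipliers. -}

module Defs where

open import Data.Nat using (ℕ; zero; suc; _+_; _*_; _<_; _≤_; NonZero)
open import Data.Nat.DivMod using (_/_; _%_)
open import Data.List using (List; []; _∷_; reverse)
open import Data.Nat.ListAction using (sum)
open import Data.Product using (_×_; ∃)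
open import Relation.Binary.PropositionalEquality using (_≡_)

-- Base-b digits of n, least significant first (empty list for n = 0).
-- The fuel argument bounds recursion depth; fuel = n always suffices
-- for b ≥ 2, since n has at most n digits.
digitsAux : (b : ℕ) → .{{NonZero b}} → ℕ → ℕ → List ℕ
digitsAux b zero    n       = []
digitsAux b (suc f) zero    = []
digitsAux b (suc f) (suc n) = (suc n % b) ∷ digitsAux b f (suc n / b)

digits : (b : ℕ) → .{{NonZero b}} → ℕ → List ℕ
digits b n = digitsAux b n n

fromDigits : ℕ → List ℕ → ℕ
fromDigits b []       = 0
fromDigits b (d ∷ ds) = d + b * fromDigits b ds

digitSum : (b : ℕ) → .{{NonZero b}} → ℕ → ℕ
digitSum b n = sum (digits b n)

rev : (b : ℕ) → .{{NonZero b}} → ℕ → ℕ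
rev b n = fromDigits b (reverse (digits b n))

IsAddMult : (b : ℕ) → .{{NonZero b}} → ℕ → ℕ → Set
IsAddMult b N M = 0 < M × N ≡ M * digitSum b N + rev b (M * digitSum b N)
IsARH : (b : ℕ) → .{{NonZero b}} → ℕ → Set
IsARH b N = 0 < N × ∃ λ M → IsAddMult b N M

module Submission where

-- Digit lists are written least significant digit first.  For a bit string u of
-- length h put  mirror u = u ++ reverse (complement of u),  a 0/1 digit list of
-- length 2h whose j-th and (2h-1-j)-th digits sum to 1.  If X is its value, then
-- X + X^R is the repunit 11…1 of length 2h, whose digit sum is 2h.  If u starts
-- with z ≥ 1 zero bits, then X = b^z · M for a positive M, and the leading digit of
-- X is 1, so the digits of X are exactly mirror u.  Hence, whenever 2h = b^z, the
-- number M satisfies M · s_b(N) = X for the repunit N of length b^z, i.e. M is an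
-- additive multiplier of N; and distinct u give distinct M.  For b = 2c one takes
-- h = c·b^t, z = t+1 and the bit strings 0^z 1^k 0^(h-z-k), k = 0, …, m-1.

open import Defs
open import Data.Bool using (Bool; true; false; not)
open import Data.Empty using (⊥-elim)
open import Data.Fin using (Fin; toℕ; zero)
open import Data.Fin.Properties using (toℕ-injective; toℕ≤pred[n])
open import Data.List using (List; []; _∷_; _++_; [_]; map; reverse; replicate; length)
open import Data.List.Properties
  using (∷-injectiveˡ; ∷-injectiveʳ; ++-assoc; ++-cancelˡ; length-++; length-map;
         length-replicate; length-reverse; map-++; map-injective; map-replicate;
         reverse-++; reverse-involutive; reverse-map; unfold-reverse)
import Data.List.Relation.Unary.All as All
open All using (All; universal)
open import Data.List.Relation.Unary.All.Properties using (++⁺; map⁺; replicate⁺)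
open import Data.Nat using (ℕ; zero; suc; _+_; _*_; _∸_; _^_; _≤_; _<_; z≤n; s≤s; NonZero; >-nonZero; >-nonZero⁻¹)
open import Data.Nat.DivMod using (_%_; _/_; [m+kn]%n≡m%n; m<n⇒m%n≡m; +-distrib-/-∣ʳ; m<n⇒m/n≡0; m*n/n≡m)
open import Data.Nat.Divisibility using (_∣_; divides; m∣m*n)
open import Data.Nat.ListAction using (sum)
open import Data.Nat.Properties
open import Data.Nat.Tactic.RingSolver using (solve-∀)
open import Data.Product using (Σ; _×_; _,_)
open import Function.Definitions using (Injective)
open import Relation.Nullary using (¬_)
open import Relation.Binary.PropositionalEquality using (_≡_; refl; sym; trans; cong; cong₂; subst; module ≡-Reasoning)

bit : Bool → ℕ
bit true  = 1
bit false = 0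

cobit : Bool → ℕ
cobit β = bit (not β)

bit+cobit≡1 : ∀ β → bit β + cobit β ≡ 1
bit+cobit≡1 true  = refl
bit+cobit≡1 false = refl

bit-injective : Injective _≡_ _≡_ bit
bit-injective {true}  {true}  _  = refl
bit-injective {true}  {false} ()
bit-injective {false} {true}  ()
bit-injective {false} {false} _  = refl

++-cancel-prefix : ∀ {A : Set} (xs ys : List A) {zs ws : List A} →
  length xs ≡ length ys → xs ++ zs ≡ ys ++ ws → xs ≡ ys
++-cancel-prefix []       []       _ _ = refl
++-cancel-prefix (x ∷ xs) (y ∷ ys) l e =
  cong₂ _∷_ (∷-injectiveˡ e) (++-cancel-prefix xs ys (suc-injective l) (∷-injectiveʳ e))

replicate-+ : ∀ {A : Set} m n (x : A) → replicate (m + n) x ≡ replicate m x ++ replicate n x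
replicate-+ zero    n x = refl
replicate-+ (suc m) n x = cong (x ∷_) (replicate-+ m n x)

block : ℕ → ℕ → List Bool
block n k = replicate k true ++ replicate (n ∸ k) false

length-block : ∀ {n k} → k ≤ n → length (block n k) ≡ n
length-block {n} {k} k≤n = begin
  length (replicate k true ++ replicate (n ∸ k) false)
    ≡⟨ length-++ (replicate k true) ⟩
  length (replicate k true) + length (replicate (n ∸ k) false)
    ≡⟨ cong₂ _+_ (length-replicate k) (length-replicate (n ∸ k)) ⟩
  k + (n ∸ k)
    ≡⟨ m+[n∸m]≡n k≤n ⟩
  n ∎
  where open ≡-Reasoning

ones-block : ∀ k r → sum (map bit (replicate k true ++ replicate r false)) ≡ k
ones-block zero    r = no-ones r
  where
  no-ones : ∀ r → sum (map bit (replicate r false)) ≡ 0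
  no-ones zero    = refl
  no-ones (suc r) = no-ones r
ones-block (suc k) r = cong suc (ones-block k r)

block-injective : ∀ {n k j} → block n k ≡ block n j → k ≡ j
block-injective {n} {k} {j} e =
  trans (sym (ones-block k (n ∸ k))) (trans (cong (λ u → sum (map bit u)) e) (ones-block j (n ∸ j)))

n<b^n : ∀ {b} → 1 < b → ∀ n → n < b ^ n
n<b^n 1<b zero = s≤s z≤n
n<b^n {b} 1<b (suc n) = begin
  suc (suc n)         ≡⟨ +-comm 1 (suc n) ⟩
  suc n + 1           ≤⟨ +-mono-≤ ih (≤-trans (≤-trans (s≤s z≤n) ih) (m≤m+n (b ^ n) 0)) ⟩
  b ^ n + (b ^ n + 0) ≤⟨ *-monoˡ-≤ (b ^ n) 1<b ⟩
  b * b ^ n           ∎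
  where
  open ≤-Reasoning
  ih : suc n ≤ b ^ n
  ih = n<b^n 1<b n

module Digits (b : ℕ) .{{_ : NonZero b}} (1<b : 1 < b) where

  ⟦_⟧ : List ℕ → ℕ
  ⟦_⟧ = fromDigits b

  ⟦⟧-++ : ∀ xs ys → ⟦ xs ++ ys ⟧ ≡ ⟦ xs ⟧ + b ^ length xs * ⟦ ys ⟧
  ⟦⟧-++ []       ys = sym (+-identityʳ ⟦ ys ⟧)
  ⟦⟧-++ (x ∷ xs) ys =
    trans (cong (λ v → x + b * v) (⟦⟧-++ xs ys)) (shift b x ⟦ xs ⟧ (b ^ length xs) ⟦ ys ⟧)
    where
    shift : ∀ b x A P C → x + b * (A + P * C) ≡ (x + b * A) + (b * P) * C
    shift = solve-∀

  ⟦⟧-zeros : ∀ z ys → ⟦ replicate z 0 ++ ys ⟧ ≡ b ^ z * ⟦ ys ⟧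
  ⟦⟧-zeros zero    ys = sym (+-identityʳ ⟦ ys ⟧)
  ⟦⟧-zeros (suc z) ys = trans (cong (b *_) (⟦⟧-zeros z ys)) (sym (*-assoc b (b ^ z) ⟦ ys ⟧))

  %-digit : ∀ d v → d < b → (d + b * v) % b ≡ d
  %-digit d v d<b = begin
    (d + b * v) % b ≡⟨ cong (λ x → (d + x) % b) (*-comm b v) ⟩
    (d + v * b) % b ≡⟨ [m+kn]%n≡m%n d v b ⟩
    d % b           ≡⟨ m<n⇒m%n≡m d<b ⟩
    d               ∎
    where open ≡-Reasoning

  /-digit : ∀ d v → d < b → (d + b * v) / b ≡ v
  /-digit d v d<b = begin
    (d + b * v) / b     ≡⟨ +-distrib-/-∣ʳ d (m∣m*n v) ⟩
    d / b + b * v / b   ≡⟨ cong₂ _+_ (m<n⇒m/n≡0 d<b) (cong (_/ b) (*-comm b v)) ⟩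
    v * b / b           ≡⟨ m*n/n≡m v b ⟩
    v                   ∎
    where open ≡-Reasoning

  digitsAux-zero : ∀ f → digitsAux b f 0 ≡ []
  digitsAux-zero zero    = refl
  digitsAux-zero (suc f) = refl

  digitsAux-step : ∀ f n → 0 < n → digitsAux b (suc f) n ≡ n % b ∷ digitsAux b f (n / b)
  digitsAux-step f (suc n) _ = refl

  digitsAux-cons : ∀ f y zs → y < b → 0 < ⟦ y ∷ zs ⟧ →
    digitsAux b (suc f) ⟦ y ∷ zs ⟧ ≡ y ∷ digitsAux b f ⟦ zs ⟧
  digitsAux-cons f y zs y<b pos =
    trans (digitsAux-step f ⟦ y ∷ zs ⟧ pos)
          (cong₂ _∷_ (%-digit y ⟦ zs ⟧ y<b) (cong (digitsAux b f) (/-digit y ⟦ zs ⟧ y<b)))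

  ⟦⟧-snoc-positive : ∀ ys {d} → 0 < d → 0 < ⟦ ys ++ [ d ] ⟧
  ⟦⟧-snoc-positive []       0<d = ≤-trans 0<d (m≤m+n _ _)
  ⟦⟧-snoc-positive (y ∷ ys) 0<d =
    ≤-trans (⟦⟧-snoc-positive ys 0<d) (≤-trans (m≤n*m _ b) (m≤n+m _ y))

  length≤⟦⟧ : ∀ ys {d} → 0 < d → length (ys ++ [ d ]) ≤ ⟦ ys ++ [ d ] ⟧
  length≤⟦⟧ []       0<d = ≤-trans 0<d (m≤m+n _ _)
  length≤⟦⟧ (y ∷ ys) 0<d = begin
    suc (length (ys ++ [ _ ])) ≡⟨ +-comm 1 _ ⟩
    length (ys ++ [ _ ]) + 1   ≤⟨ +-mono-≤ (length≤⟦⟧ ys 0<d) (≤-trans (⟦⟧-snoc-positive ys 0<d) (≤-reflexive (sym (+-identityʳ _)))) ⟩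
    r + (r + 0)                ≤⟨ *-monoˡ-≤ r 1<b ⟩
    b * r                      ≤⟨ m≤n+m (b * r) y ⟩
    y + b * r                  ∎
    where
    open ≤-Reasoning
    r = ⟦ ys ++ [ _ ] ⟧

  digitsAux-canonical : ∀ f ys {d} → All (_< b) ys → 0 < d → d < b →
    length (ys ++ [ d ]) ≤ f → digitsAux b f ⟦ ys ++ [ d ] ⟧ ≡ ys ++ [ d ]
  digitsAux-canonical (suc f) [] {d} All.[] 0<d d<b _ =
    trans (digitsAux-cons f d [] d<b (⟦⟧-snoc-positive [] 0<d)) (cong (d ∷_) (digitsAux-zero f))
  digitsAux-canonical (suc f) (y ∷ ys) (y<b All.∷ ys<b) 0<d d<b (s≤s len≤f) =
    trans (digitsAux-cons f y (ys ++ [ _ ]) y<b (⟦⟧-snoc-positive (y ∷ ys) 0<d))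
          (cong (y ∷_) (digitsAux-canonical f ys ys<b 0<d d<b len≤f))

  digits-canonical : ∀ ys {d} → All (_< b) ys → 0 < d → d < b →
    digits b ⟦ ys ++ [ d ] ⟧ ≡ ys ++ [ d ]
  digits-canonical ys ys<b 0<d d<b = digitsAux-canonical _ ys ys<b 0<d d<b (length≤⟦⟧ ys 0<d)

  repunit : ℕ → ℕ
  repunit n = ⟦ replicate n 1 ⟧

  repunit-+ : ∀ m n → repunit (m + n) ≡ repunit m + b ^ m * repunit n
  repunit-+ m n = begin
    ⟦ replicate (m + n) 1 ⟧                                    ≡⟨ cong ⟦_⟧ (replicate-+ m n 1) ⟩
    ⟦ replicate m 1 ++ replicate n 1 ⟧                         ≡⟨ ⟦⟧-++ (replicate m 1) (replicate n 1) ⟩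
    repunit m + b ^ length (replicate m 1) * repunit n         ≡⟨ cong (λ k → repunit m + b ^ k * repunit n) (length-replicate m) ⟩
    repunit m + b ^ m * repunit n                              ∎
    where open ≡-Reasoning

  repunit-positive : ∀ {n} → 0 < n → 0 < repunit n
  repunit-positive {suc n} _ = s≤s z≤n

  digitSum-repunit : ∀ n → digitSum b (repunit n) ≡ n
  digitSum-repunit zero    = refl
  digitSum-repunit (suc n) = begin
    sum (digits b ⟦ replicate (suc n) 1 ⟧)  ≡⟨ cong (λ l → sum (digits b ⟦ l ⟧)) snoc ⟩
    sum (digits b ⟦ replicate n 1 ++ [ 1 ] ⟧) ≡⟨ cong sum (digits-canonical (replicate n 1) (replicate⁺ n 1<b) (s≤s z≤n) 1<b) ⟩
    sum (replicate n 1 ++ [ 1 ])              ≡⟨ cong sum (sym snoc) ⟩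
    sum (replicate (suc n) 1)                 ≡⟨ sum-ones (suc n) ⟩
    suc n                                     ∎
    where
    open ≡-Reasoning
    snoc : replicate (suc n) 1 ≡ replicate n 1 ++ [ 1 ]
    snoc = trans (cong (λ k → replicate k 1) (+-comm 1 n)) (replicate-+ n 1 1)
    sum-ones : ∀ k → sum (replicate k 1) ≡ k
    sum-ones zero    = refl
    sum-ones (suc k) = cong suc (sum-ones k)

  mirror : List Bool → List ℕ
  mirror u = map bit u ++ reverse (map cobit u)

  ⟦mirror⟧ : ∀ (f g : Bool → ℕ) u →
    ⟦ map f u ++ reverse (map g u) ⟧ ≡ ⟦ map f u ⟧ + b ^ length u * ⟦ map g (reverse u) ⟧
  ⟦mirror⟧ f g u = begin
    ⟦ map f u ++ reverse (map g u) ⟧                             ≡⟨ ⟦⟧-++ (map f u) (reverse (map g u)) ⟩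
    ⟦ map f u ⟧ + b ^ length (map f u) * ⟦ reverse (map g u) ⟧  ≡⟨ cong₂ (λ k l → ⟦ map f u ⟧ + b ^ k * ⟦ l ⟧) (length-map f u) (sym (reverse-map g u)) ⟩
    ⟦ map f u ⟧ + b ^ length u * ⟦ map g (reverse u) ⟧          ∎
    where open ≡-Reasoning

  reverse-mirror : ∀ u → reverse (mirror u) ≡ map cobit u ++ reverse (map bit u)
  reverse-mirror u = trans (reverse-++ (map bit u) (reverse (map cobit u)))
                           (cong (_++ reverse (map bit u)) (reverse-involutive (map cobit u)))

  ⟦bit⟧+⟦cobit⟧ : ∀ u → ⟦ map bit u ⟧ + ⟦ map cobit u ⟧ ≡ repunit (length u)
  ⟦bit⟧+⟦cobit⟧ []      = refl
  ⟦bit⟧+⟦cobit⟧ (β ∷ u) =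
    trans (regroup b (bit β) (cobit β) ⟦ map bit u ⟧ ⟦ map cobit u ⟧)
          (cong₂ (λ p q → p + b * q) (bit+cobit≡1 β) (⟦bit⟧+⟦cobit⟧ u))
    where
    regroup : ∀ b x y A B → (x + b * A) + (y + b * B) ≡ (x + y) + b * (A + B)
    regroup = solve-∀

  mirror+reverse : ∀ u → ⟦ mirror u ⟧ + ⟦ reverse (mirror u) ⟧ ≡ repunit (length u + length u)
  mirror+reverse u = begin
    ⟦ mirror u ⟧ + ⟦ reverse (mirror u) ⟧
      ≡⟨ cong₂ _+_ (⟦mirror⟧ bit cobit u) (trans (cong ⟦_⟧ (reverse-mirror u)) (⟦mirror⟧ cobit bit u)) ⟩
    (A + P * B′) + (B + P * A′)
      ≡⟨ regroup A B A′ B′ P ⟩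
    (A + B) + P * (A′ + B′)
      ≡⟨ cong₂ (λ x y → x + P * y) (⟦bit⟧+⟦cobit⟧ u)
               (trans (⟦bit⟧+⟦cobit⟧ (reverse u)) (cong repunit (length-reverse u))) ⟩
    repunit h + P * repunit h
      ≡⟨ sym (repunit-+ h h) ⟩
    repunit (h + h) ∎
    where
    open ≡-Reasoning
    h = length u
    P = b ^ h
    A = ⟦ map bit u ⟧
    B = ⟦ map cobit u ⟧
    A′ = ⟦ map bit (reverse u) ⟧
    B′ = ⟦ map cobit (reverse u) ⟧
    regroup : ∀ A B A′ B′ P → (A + P * B′) + (B + P * A′) ≡ (A + B) + P * (A′ + B′)
    regroup = solve-∀

  mirror-snoc : ∀ u → mirror (false ∷ u) ≡ (map bit (false ∷ u) ++ reverse (map cobit u)) ++ [ 1 ]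
  mirror-snoc u = begin
    map bit (false ∷ u) ++ reverse (map cobit (false ∷ u))  ≡⟨ cong (map bit (false ∷ u) ++_) (unfold-reverse 1 (map cobit u)) ⟩
    map bit (false ∷ u) ++ (reverse (map cobit u) ++ [ 1 ]) ≡⟨ sym (++-assoc (map bit (false ∷ u)) _ [ 1 ]) ⟩
    (map bit (false ∷ u) ++ reverse (map cobit u)) ++ [ 1 ] ∎
    where open ≡-Reasoning

  digits-mirror : ∀ u → digits b ⟦ mirror (false ∷ u) ⟧ ≡ mirror (false ∷ u)
  digits-mirror u = begin
    digits b ⟦ mirror (false ∷ u) ⟧ ≡⟨ cong (λ l → digits b ⟦ l ⟧) (mirror-snoc u) ⟩
    digits b ⟦ ys ++ [ 1 ] ⟧        ≡⟨ digits-canonical ys ys<b (s≤s z≤n) 1<b ⟩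
    ys ++ [ 1 ]                     ≡⟨ sym (mirror-snoc u) ⟩
    mirror (false ∷ u)              ∎
    where
    open ≡-Reasoning
    ys = map bit (false ∷ u) ++ reverse (map cobit u)
    bit<b : ∀ β → bit β < b
    bit<b true  = 1<b
    bit<b false = <-trans (s≤s z≤n) 1<b
    ys<b : All (_< b) ys
    ys<b = ++⁺ (map⁺ (universal bit<b (false ∷ u)))
               (subst (All (_< b)) (reverse-map cobit u) (map⁺ (universal (λ β → bit<b (not β)) (reverse u))))

  mirror-positive : ∀ u → 0 < ⟦ mirror (false ∷ u) ⟧
  mirror-positive u = subst (λ l → 0 < ⟦ l ⟧) (sym (mirror-snoc u))
                            (⟦⟧-snoc-positive (map bit (false ∷ u) ++ reverse (map cobit u)) (s≤s z≤n))

  -- A bit string v preceded by z zero bits, and the multiplier it determines: the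
  -- value of its mirror with the z least significant (zero) digits removed.
  padded : ℕ → List Bool → List Bool
  padded z v = replicate z false ++ v

  multiplier : ℕ → List Bool → ℕ
  multiplier z v = ⟦ map bit v ++ reverse (map cobit (padded z v)) ⟧

  length-padded : ∀ z v → length (padded z v) ≡ z + length v
  length-padded z v = trans (length-++ (replicate z false)) (cong (_+ length v) (length-replicate z))

  ⟦mirror-padded⟧ : ∀ z v → ⟦ mirror (padded z v) ⟧ ≡ b ^ z * multiplier z v
  ⟦mirror-padded⟧ z v = begin
    ⟦ map bit (replicate z false ++ v) ++ R ⟧   ≡⟨ cong (λ l → ⟦ l ++ R ⟧) (map-++ bit (replicate z false) v) ⟩
    ⟦ (map bit (replicate z false) ++ map bit v) ++ R ⟧ ≡⟨ cong (λ l → ⟦ (l ++ map bit v) ++ R ⟧) (map-replicate bit z false) ⟩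
    ⟦ (replicate z 0 ++ map bit v) ++ R ⟧       ≡⟨ cong ⟦_⟧ (++-assoc (replicate z 0) (map bit v) R) ⟩
    ⟦ replicate z 0 ++ (map bit v ++ R) ⟧       ≡⟨ ⟦⟧-zeros z (map bit v ++ R) ⟩
    b ^ z * multiplier z v                      ∎
    where
    open ≡-Reasoning
    R = reverse (map cobit (padded z v))

  multiplier-isAddMult : ∀ z v → let h = length (padded (suc z) v) in
    b ^ suc z ≡ h + h → IsAddMult b (repunit (b ^ suc z)) (multiplier (suc z) v)
  multiplier-isAddMult z v L≡h+h = M-positive , sym (begin
    M * digitSum b (repunit L) + rev b (M * digitSum b (repunit L))
      ≡⟨ cong (λ x → x + rev b x) M*s≡X ⟩
    X + ⟦ reverse (digits b X) ⟧
      ≡⟨ cong (λ l → X + ⟦ reverse l ⟧) (digits-mirror (padded z v)) ⟩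
    X + ⟦ reverse (mirror u) ⟧
      ≡⟨ mirror+reverse u ⟩
    repunit (length u + length u)
      ≡⟨ cong repunit (sym L≡h+h) ⟩
    repunit L ∎)
    where
    open ≡-Reasoning
    u = padded (suc z) v
    L = b ^ suc z
    M = multiplier (suc z) v
    X = ⟦ mirror u ⟧
    X≡L*M : X ≡ L * M
    X≡L*M = ⟦mirror-padded⟧ (suc z) v
    M*s≡X : M * digitSum b (repunit L) ≡ X
    M*s≡X = trans (cong (M *_) (digitSum-repunit L)) (trans (*-comm M L) (sym X≡L*M))
    M-positive : 0 < M
    M-positive = >-nonZero⁻¹ M {{m*n≢0⇒n≢0 L {{>-nonZero (subst (0 <_) X≡L*M (mirror-positive (padded z v)))}}}}

  -- Distinct strings of equal length give distinct multipliers, since the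
  -- digits of b^(z+1)·M are the mirror of the padded string.
  multiplier-injective : ∀ z {v w} → length v ≡ length w →
    multiplier (suc z) v ≡ multiplier (suc z) w → v ≡ w
  multiplier-injective z {v} {w} len eq = ++-cancelˡ (replicate (suc z) false) v w same-padded
    where
    same-mirror : mirror (padded (suc z) v) ≡ mirror (padded (suc z) w)
    same-mirror = begin
      mirror (padded (suc z) v)                         ≡⟨ sym (digits-mirror (padded z v)) ⟩
      digits b ⟦ mirror (padded (suc z) v) ⟧           ≡⟨ cong (digits b) (⟦mirror-padded⟧ (suc z) v) ⟩
      digits b (b ^ suc z * multiplier (suc z) v)       ≡⟨ cong (λ x → digits b (b ^ suc z * x)) eq ⟩
      digits b (b ^ suc z * multiplier (suc z) w)       ≡⟨ cong (digits b) (sym (⟦mirror-padded⟧ (suc z) w)) ⟩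
      digits b ⟦ mirror (padded (suc z) w) ⟧           ≡⟨ digits-mirror (padded z w) ⟩
      mirror (padded (suc z) w)                         ∎
      where open ≡-Reasoning
    length-bits : ∀ x → length (map bit (padded (suc z) x)) ≡ suc z + length x
    length-bits x = trans (length-map bit (padded (suc z) x)) (length-padded (suc z) x)
    same-padded : padded (suc z) v ≡ padded (suc z) w
    same-padded = map-injective bit-injective
      (++-cancel-prefix (map bit (padded (suc z) v)) (map bit (padded (suc z) w))
        (trans (length-bits v) (trans (cong (suc z +_) len) (sym (length-bits w)))) same-mirror)

-- With
-- t = n+1, z = t+1 and h = c·b^t we have 2h = b^z, and the strings 0^z 1^k 0^(h-z-k)
-- (k ≤ n) have length h; the room h - z suffices because z + n ≤ h.
module EvenBase (b : ℕ) .{{_ : NonZero b}} (2≤b : 2 ≤ b)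
                (c : ℕ) .{{_ : NonZero c}} (b≡c*2 : b ≡ c * 2) (n : ℕ) where

  open Digits b 2≤b

  t z h r : ℕ
  t = suc n
  z = suc t
  h = c * b ^ t
  r = h ∸ z

  b^z≡h+h : b ^ z ≡ h + h
  b^z≡h+h = trans (cong (_* b ^ t) b≡c*2) (double c (b ^ t))
    where
    double : ∀ c P → (c * 2) * P ≡ c * P + c * P
    double = solve-∀

  z+n≤h : z + n ≤ h
  z+n≤h = begin
    z + n       ≡⟨ twice n ⟩
    2 * suc n   ≤⟨ *-monoʳ-≤ 2 (n<b^n 2≤b n) ⟩
    2 * b ^ n   ≤⟨ *-monoˡ-≤ (b ^ n) 2≤b ⟩
    b ^ t       ≤⟨ m≤n*m (b ^ t) c ⟩
    h           ∎
    where
    open ≤-Reasoning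
    twice : ∀ n → suc (suc n) + n ≡ 2 * suc n
    twice = solve-∀

  n≤r : n ≤ r
  n≤r = subst (_≤ r) (m+n∸m≡n z n) (∸-monoˡ-≤ z z+n≤h)

  N : ℕ
  N = repunit (b ^ z)

  N-positive : 0 < N
  N-positive = repunit-positive (m^n>0 b z)

  bits : Fin (suc n) → List Bool
  bits i = block r (toℕ i)

  length-bits : ∀ i → length (bits i) ≡ r
  length-bits i = length-block (≤-trans (toℕ≤pred[n] i) n≤r)

  M : Fin (suc n) → ℕ
  M i = multiplier z (bits i)

  M-isAddMult : ∀ i → IsAddMult b N (M i)
  M-isAddMult i = multiplier-isAddMult t (bits i) (trans b^z≡h+h (sym (cong₂ _+_ len len)))
    where
    len : length (padded z (bits i)) ≡ h
    len = trans (length-padded z (bits i))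
                (trans (cong (z +_) (length-bits i)) (m+[n∸m]≡n (≤-trans (m≤m+n z n) z+n≤h)))

  M-injective : Injective _≡_ _≡_ M
  M-injective {i} {j} eq = toℕ-injective (block-injective
    (multiplier-injective t (trans (length-bits i) (sym (length-bits j))) eq))

corollary22 : (b : ℕ) → .{{_ : NonZero b}} → 2 ≤ b → 2 ∣ b → (m : ℕ) → 0 < m →
    Σ ℕ λ N → IsARH b N × Σ (Fin m → ℕ) λ Ms →
      Injective _≡_ _≡_ Ms × ((i : Fin m) → IsAddMult b N (Ms i))
corollary22 b 2≤b (divides zero b≡0) m _ = ⊥-elim (2≰0 (subst (2 ≤_) b≡0 2≤b))
  where
  2≰0 : ¬ (2 ≤ 0)
  2≰0 ()
corollary22 b 2≤b (divides (suc c) b≡2c) (suc n) _ =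
  N , (N-positive , M zero , M-isAddMult zero) , M , M-injective , M-isAddMult
  where open EvenBase b 2≤b (suc c) b≡2c n
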